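{- If $\Delta$ is a normal $(d-1)$-pseudomanifold with exactly $d+2$ vertices, then $\Delta$ is the join of the boundary complexes of two simplices.
   Context: A normal $(d-1)$-pseudomanifold is a pure connected $(d-1)$-dimensional simplicial complex in which every $(d-2)$-face lies in exactly two facets and the link of every face of dimension $\leq d-3$ is connected. -}

module Defs where

open import Data.Nat using (ℕ; _+_; _≤_)
open import Data.Bool using (Bool; true)
open import Data.Fin using (Fin)
open import Data.Fin.Subset using (Subset; ⊥; ⁅_⁆; _⊆_; _∪_; _∩_; ∁; ∣_∣; Nonempty; Empty)
open import Data.Product using (Σ; ∃; _×_)
open import Data.Sum using (_⊎_)
open import Relation.Binary.PropositionalEquality using (_≡_; _≢_)

record SimplicialComplex (n : ℕ) : Set where
  field
    isFace      : Subset n → Bool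
    empty-face  : isFace ⊥ ≡ true
    down-closed : ∀ {σ τ} → σ ⊆ τ → isFace τ ≡ true → isFace σ ≡ true
    vertex      : ∀ (i : Fin n) → isFace ⁅ i ⁆ ≡ true

open SimplicialComplex public

module _ {n : ℕ} (Δ : SimplicialComplex n) where

  Face : Subset n → Set
  Face σ = isFace Δ σ ≡ true

  Facet : Subset n → Set
  Facet σ = Face σ × (∀ τ → Face τ → σ ⊆ τ → τ ≡ σ)

  Link : Subset n → Subset n → Set
  Link σ τ = Face (τ ∪ σ) × Empty (τ ∩ σ)

module _ {n : ℕ} (K : Subset n → Set) where

  IsVertex : Fin n → Set
  IsVertex v = K ⁅ v ⁆

  IsEdge : Fin n → Fin n → Set
  IsEdge u v = K (⁅ u ⁆ ∪ ⁅ v ⁆)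

  data Reach : Fin n → Fin n → Set where
    here : ∀ {v} → IsVertex v → Reach v v
    step : ∀ {u v w} → IsEdge u v → Reach v w → Reach u w

  Connected : Set
  Connected = (∃ λ v → IsVertex v) × (∀ u v → IsVertex u → IsVertex v → Reach u v)

record NormalPseudomanifold {n : ℕ} (d : ℕ) (Δ : SimplicialComplex n) : Set where
  field
    pure      : ∀ σ → Facet Δ σ → ∣ σ ∣ ≡ d
    connected : Connected (Face Δ)
    ridge     : ∀ σ → Face Δ σ → ∣ σ ∣ + 1 ≡ d →
                Σ (Subset n) λ τ₁ → Σ (Subset n) λ τ₂ →
                  τ₁ ≢ τ₂ × Facet Δ τ₁ × Facet Δ τ₂ × σ ⊆ τ₁ × σ ⊆ τ₂ ×
                  (∀ τ → Facet Δ τ → σ ⊆ τ → τ ≡ τ₁ ⊎ τ ≡ τ₂)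
    link-conn : ∀ σ → Face Δ σ → ∣ σ ∣ + 2 ≤ d → Connected (Link Δ σ)

BoundaryOfSimplex : ∀ {n} → Subset n → Subset n → Set
BoundaryOfSimplex A σ = σ ⊆ A × σ ≢ A

-- Join of the boundaries of the simplices on A and on its complement ∁ A
-- (disjoint vertex sets covering Fin n): faces are σ = σ₁ ∪ σ₂ with
-- σ₁ ∈ ∂A, σ₂ ∈ ∂(∁ A), i.e. σ ∩ A ∈ ∂A and σ ∩ ∁A ∈ ∂(∁A).
JoinOfBoundaries : ∀ {n} → Subset n → Subset n → Set
JoinOfBoundaries A σ = BoundaryOfSimplex A (σ ∩ A) × BoundaryOfSimplex (∁ A) (σ ∩ ∁ A)

IsJoinOfTwoSimplexBoundaries : ∀ {n} → SimplicialComplex n → Set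
IsJoinOfTwoSimplexBoundaries {n} Δ =
  Σ (Subset n) λ A → Nonempty A × Nonempty (∁ A) ×
    (∀ σ → (Face Δ σ → JoinOfBoundaries A σ) × (JoinOfBoundaries A σ → Face Δ σ))

-- The facets of Δ have d of the d + 2 vertices, so each is the complement of a
-- pair {a, b}; call such a pair a cofacet.  For distinct a, b, c the ridge
-- V ∖ {a, b, c} lies in exactly the facets V ∖ {x, y} with {x, y} ⊆ {a, b, c} a
-- cofacet, so whenever one of the three pairs is a cofacet exactly two are.
-- Hence cofacet(x, y) = cofacet(b₀, x) xor cofacet(b₀, y) for any fixed b₀:
-- the cofacets are the edges of the complete bipartite graph between
-- A = {x | b₀x is a cofacet} and its complement, and the faces of Δ are exactly
-- the sets missing a vertex of A and a vertex of ∁ A.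
module Submission where

open import Defs
open import Data.Nat using (ℕ; zero; suc; _+_; _≤_; _<_; s≤s; z≤n)
open import Data.Nat.Properties using (m∸n+n≡m; m≤m+n; +-suc; +-assoc; +-cancelʳ-≡; <⇒≱; <-irrefl; m<m+n; n<1+n)
open import Data.Bool using (Bool; true; false; _xor_)
open import Data.Bool.Properties using (xor-same; xor-identityʳ; ¬-not; not-¬) renaming (_≟_ to _≟ᵇ_)
open import Data.Fin using (Fin; zero; suc) renaming (_≟_ to _≟ᶠ_)
open import Data.Fin.Properties using (any?; ¬∀⟶∃¬)
open import Data.Fin.Subset
  using (Subset; ⊥; ⊤; ⁅_⁆; _⊆_; _⊈_; _∪_; ∁; ∣_∣; _∈_; _∉_; inside; outside)
open import Data.Fin.Subset.Properties
open import Data.Vec using (_∷_; tabulate) renaming (here to vhere; there to vthere)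
open import Data.Vec.Properties using (lookup∘tabulate; []=⇒lookup; lookup⇒[]=)
open import Data.Product using (∃; ∃₂; _×_; _,_; proj₁)
open import Data.Sum as Sum using (_⊎_; inj₁; inj₂; [_,_])
open import Data.Empty using (⊥-elim)
open import Relation.Nullary using (Dec; yes; no)
open import Relation.Nullary.Decidable using (_→-dec_; ¬?; _×-dec_; decidable-stable)
open import Relation.Binary.PropositionalEquality
  using (_≡_; _≢_; ≢-sym; refl; sym; trans; cong; cong₂; subst; subst₂; module ≡-Reasoning)

module _ {n : ℕ} where

  p⊈q⇒∃x∈p∉q : {p q : Subset n} → p ⊈ q → ∃ λ x → x ∈ p × x ∉ q
  p⊈q⇒∃x∈p∉q {p} {q} p⊈q
    with ¬∀⟶∃¬ n (λ x → x ∈ p → x ∈ q) (λ x → x ∈? p →-dec x ∈? q) (λ p⊆q → p⊈q (p⊆q _))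
  ... | x , x∈p↛x∈q =
    x , decidable-stable (x ∈? p) (λ x∉p → x∈p↛x∈q (λ x∈p → ⊥-elim (x∉p x∈p)))
      , (λ x∈q → x∈p↛x∈q (λ _ → x∈q))

  ∣q∣<∣p∣⇒∃x∈p∉q : {p q : Subset n} → ∣ q ∣ < ∣ p ∣ → ∃ λ x → x ∈ p × x ∉ q
  ∣q∣<∣p∣⇒∃x∈p∉q ∣q∣<∣p∣ = p⊈q⇒∃x∈p∉q (λ p⊆q → <⇒≱ ∣q∣<∣p∣ (p⊆q⇒∣p∣≤∣q∣ p⊆q))

  p⊆q∧∣p∣≡∣q∣⇒p≡q : {p q : Subset n} → p ⊆ q → ∣ p ∣ ≡ ∣ q ∣ → p ≡ q
  p⊆q∧∣p∣≡∣q∣⇒p≡q {p} {q} p⊆q ∣p∣≡∣q∣ with q ⊆? p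
  ... | yes q⊆p = ⊆-antisym p⊆q q⊆p
  ... | no q⊈p = ⊥-elim (<-irrefl ∣p∣≡∣q∣ (p⊂q⇒∣p∣<∣q∣ (p⊆q , p⊈q⇒∃x∈p∉q q⊈p)))

  ∣∁p∣+∣p∣≡n : (p : Subset n) → ∣ ∁ p ∣ + ∣ p ∣ ≡ n
  ∣∁p∣+∣p∣≡n p = trans (cong (_+ ∣ p ∣) (∣∁p∣≡n∸∣p∣ p)) (m∸n+n≡m (∣p∣≤n p))

⁅x⁆∪p⊆q : ∀ {n} {x : Fin n} {p q} → x ∈ q → p ⊆ q → ⁅ x ⁆ ∪ p ⊆ q
⁅x⁆∪p⊆q {x = x} {p} x∈q p⊆q y∈xp =
  [ (λ y∈⁅x⁆ → subst (_∈ _) (sym (x∈⁅y⁆⇒x≡y x y∈⁅x⁆)) x∈q) , p⊆q ] (x∈p∪q⁻ ⁅ x ⁆ p y∈xp)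

∣⁅x⁆∪p∣≡1+∣p∣ : ∀ {n} {x : Fin n} (p : Subset n) → x ∉ p → ∣ ⁅ x ⁆ ∪ p ∣ ≡ suc ∣ p ∣
∣⁅x⁆∪p∣≡1+∣p∣ {x = zero}  (outside ∷ p) _   = cong suc (cong ∣_∣ (∪-identityˡ p))
∣⁅x⁆∪p∣≡1+∣p∣ {x = zero}  (inside ∷ p)  x∉p = ⊥-elim (x∉p vhere)
∣⁅x⁆∪p∣≡1+∣p∣ {x = suc x} (outside ∷ p) x∉p = ∣⁅x⁆∪p∣≡1+∣p∣ p (λ x∈p → x∉p (vthere x∈p))
∣⁅x⁆∪p∣≡1+∣p∣ {x = suc x} (inside ∷ p)  x∉p = cong suc (∣⁅x⁆∪p∣≡1+∣p∣ p (λ x∈p → x∉p (vthere x∈p)))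

module _ {n : ℕ} where

  pair : Fin n → Fin n → Subset n
  pair a b = ⁅ a ⁆ ∪ ⁅ b ⁆

  triple : Fin n → Fin n → Fin n → Subset n
  triple a b c = ⁅ a ⁆ ∪ pair b c

  module _ {a b : Fin n} where

    x∈pair⁻ : ∀ {x} → x ∈ pair a b → x ≡ a ⊎ x ≡ b
    x∈pair⁻ x∈ab = Sum.map (x∈⁅y⁆⇒x≡y a) (x∈⁅y⁆⇒x≡y b) (x∈p∪q⁻ ⁅ a ⁆ ⁅ b ⁆ x∈ab)

    a∈pair : a ∈ pair a b
    a∈pair = x∈p∪q⁺ (inj₁ (x∈⁅x⁆ a))

    b∈pair : b ∈ pair a b
    b∈pair = x∈p∪q⁺ (inj₂ (x∈⁅x⁆ b))

    pair⊆ : ∀ {p} → a ∈ p → b ∈ p → pair a b ⊆ p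
    pair⊆ a∈p b∈p x∈ab = [ (λ { refl → a∈p }) , (λ { refl → b∈p }) ] (x∈pair⁻ x∈ab)

    a∉∁pair : a ∉ ∁ (pair a b)
    a∉∁pair = x∈p⇒x∉∁p a∈pair

    b∉∁pair : b ∉ ∁ (pair a b)
    b∉∁pair = x∈p⇒x∉∁p b∈pair

    ⊆∁pair : ∀ {σ} → a ∉ σ → b ∉ σ → σ ⊆ ∁ (pair a b)
    ⊆∁pair a∉σ b∉σ x∈σ = x∉p⇒x∈∁p λ x∈ab →
      [ (λ { refl → a∉σ x∈σ }) , (λ { refl → b∉σ x∈σ }) ] (x∈pair⁻ x∈ab)

    x∈∁pair⁺ : ∀ {x} → x ≢ a → x ≢ b → x ∈ ∁ (pair a b)
    x∈∁pair⁺ x≢a x≢b = ⊆∁pair (x≢y⇒x∉⁅y⁆ (≢-sym x≢a)) (x≢y⇒x∉⁅y⁆ (≢-sym x≢b)) (x∈⁅x⁆ _)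

    ∣pair∣≡2 : a ≢ b → ∣ pair a b ∣ ≡ 2
    ∣pair∣≡2 a≢b = trans (∣⁅x⁆∪p∣≡1+∣p∣ ⁅ b ⁆ (x≢y⇒x∉⁅y⁆ a≢b)) (cong suc (∣⁅x⁆∣≡1 b))

  ∁pair-comm : (a b : Fin n) → ∁ (pair a b) ≡ ∁ (pair b a)
  ∁pair-comm a b = cong ∁ (∪-comm ⁅ a ⁆ ⁅ b ⁆)

  ∣pair-a-a∣≡1 : (a : Fin n) → ∣ pair a a ∣ ≡ 1
  ∣pair-a-a∣≡1 a = trans (cong ∣_∣ (∪-idem ⁅ a ⁆)) (∣⁅x⁆∣≡1 a)

  module _ {a b c : Fin n} where

    x∈triple⁻ : ∀ {x} → x ∈ triple a b c → x ≡ a ⊎ x ≡ b ⊎ x ≡ c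
    x∈triple⁻ x∈abc = Sum.map (x∈⁅y⁆⇒x≡y a) x∈pair⁻ (x∈p∪q⁻ ⁅ a ⁆ (pair b c) x∈abc)

    a∈triple : a ∈ triple a b c
    a∈triple = x∈p∪q⁺ (inj₁ (x∈⁅x⁆ a))

    b∈triple : b ∈ triple a b c
    b∈triple = x∈p∪q⁺ (inj₂ a∈pair)

    c∈triple : c ∈ triple a b c
    c∈triple = x∈p∪q⁺ (inj₂ b∈pair)

    ∣triple∣≡3 : a ≢ b → a ≢ c → b ≢ c → ∣ triple a b c ∣ ≡ 3
    ∣triple∣≡3 a≢b a≢c b≢c =
      trans (∣⁅x⁆∪p∣≡1+∣p∣ (pair b c) (λ a∈bc → [ a≢b , a≢c ] (x∈pair⁻ a∈bc)))
            (cong suc (∣pair∣≡2 b≢c))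

module _ {n : ℕ} {f : Fin n → Bool} {x : Fin n} where

  x∈tabulate⁺ : f x ≡ true → x ∈ tabulate f
  x∈tabulate⁺ fx = lookup⇒[]= x (tabulate f) (trans (lookup∘tabulate f x) fx)

  x∈tabulate⁻ : x ∈ tabulate f → f x ≡ true
  x∈tabulate⁻ x∈f = trans (sym (lookup∘tabulate f x)) ([]=⇒lookup x∈f)

  x∉tabulate⁺ : f x ≡ false → x ∉ tabulate f
  x∉tabulate⁺ fx x∈f = not-¬ (x∈tabulate⁻ x∈f) fx

module _ {n : ℕ} {A σ : Subset n} where

  join-of-missing : ∀ {a b} → a ∈ A → a ∉ σ → b ∉ A → b ∉ σ → JoinOfBoundaries A σ
  join-of-missing {a} {b} a∈A a∉σ b∉A b∉σ =
    (p∩q⊆q σ A , λ σA≡A → a∉σ (proj₁ (x∈p∩q⁻ σ A (subst (a ∈_) (sym σA≡A) a∈A)))) ,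
    (p∩q⊆q σ (∁ A) , λ σ∁A≡∁A → b∉σ (proj₁ (x∈p∩q⁻ σ (∁ A) (subst (b ∈_) (sym σ∁A≡∁A) (x∉p⇒x∈∁p b∉A)))))

  missing-from-join : JoinOfBoundaries A σ → ∃₂ λ a b → a ∈ A × a ∉ σ × b ∉ A × b ∉ σ
  missing-from-join ((_ , σA≢A) , (_ , σ∁A≢∁A))
    with p⊈q⇒∃x∈p∉q (λ A⊆σA → σA≢A (⊆-antisym (p∩q⊆q σ A) A⊆σA))
       | p⊈q⇒∃x∈p∉q (λ ∁A⊆σ∁A → σ∁A≢∁A (⊆-antisym (p∩q⊆q σ (∁ A)) ∁A⊆σ∁A))
  ... | a , a∈A , a∉σA | b , b∈∁A , b∉σ∁A =
    a , b , a∈A , (λ a∈σ → a∉σA (x∈p∩q⁺ (a∈σ , a∈A))) ,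
    x∈∁p⇒x∉p b∈∁A , (λ b∈σ → b∉σ∁A (x∈p∩q⁺ (b∈σ , b∈∁A)))

module _ {n : ℕ} (Δ : SimplicialComplex n) where

  face? : ∀ σ → Dec (Face Δ σ)
  face? σ = isFace Δ σ ≟ᵇ true

  facet-or-extensible : ∀ σ → Face Δ σ → Facet Δ σ ⊎ ∃ λ i → i ∉ σ × Face Δ (⁅ i ⁆ ∪ σ)
  facet-or-extensible σ σ∈Δ with any? (λ i → ¬? (i ∈? σ) ×-dec face? (⁅ i ⁆ ∪ σ))
  ... | yes extension = inj₂ extension
  ... | no ¬extension = inj₁ (σ∈Δ , maximal)
    where
    maximal : ∀ τ → Face Δ τ → σ ⊆ τ → τ ≡ σ
    maximal τ τ∈Δ σ⊆τ with τ ⊆? σ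
    ... | yes τ⊆σ = ⊆-antisym τ⊆σ σ⊆τ
    ... | no τ⊈σ with p⊈q⇒∃x∈p∉q τ⊈σ
    ... | i , i∈τ , i∉σ =
      ⊥-elim (¬extension (i , i∉σ , down-closed Δ (⁅x⁆∪p⊆q i∈τ σ⊆τ) τ∈Δ))

  facet-above : ∀ σ → Face Δ σ → ∃ λ τ → Facet Δ τ × σ ⊆ τ
  facet-above σ σ∈Δ = extend n σ σ∈Δ (m≤m+n n ∣ σ ∣)
    where
    extend : ∀ k σ → Face Δ σ → n ≤ k + ∣ σ ∣ → ∃ λ τ → Facet Δ τ × σ ⊆ τ
    extend k σ σ∈Δ n≤k+∣σ∣ with facet-or-extensible σ σ∈Δ
    ... | inj₁ σ-facet = σ , σ-facet , ⊆-refl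
    extend zero σ _ n≤∣σ∣ | inj₂ (i , i∉σ , _) =
      ⊥-elim (<⇒≱ (subst (_≤ n) (∣⁅x⁆∪p∣≡1+∣p∣ σ i∉σ) (∣p∣≤n (⁅ i ⁆ ∪ σ))) n≤∣σ∣)
    extend (suc k) σ _ n≤1+k+∣σ∣ | inj₂ (i , i∉σ , iσ∈Δ)
      with extend k (⁅ i ⁆ ∪ σ) iσ∈Δ
             (subst (n ≤_) (trans (sym (+-suc k ∣ σ ∣)) (cong (k +_) (sym (∣⁅x⁆∪p∣≡1+∣p∣ σ i∉σ)))) n≤1+k+∣σ∣)
    ... | τ , τ-facet , iσ⊆τ = τ , τ-facet , ⊆-trans (q⊆p∪q ⁅ i ⁆ σ) iσ⊆τ

  ∣face∣≤d : ∀ {d} → (∀ σ → Facet Δ σ → ∣ σ ∣ ≡ d) → ∀ σ → Face Δ σ → ∣ σ ∣ ≤ d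
  ∣face∣≤d pure σ σ∈Δ with facet-above σ σ∈Δ
  ... | τ , τ-facet , σ⊆τ = subst (∣ σ ∣ ≤_) (pure τ τ-facet) (p⊆q⇒∣p∣≤∣q∣ σ⊆τ)

two-of-three-coincide : ∀ {A : Set} {x y z t₁ t₂ : A} →
  x ≡ t₁ ⊎ x ≡ t₂ → y ≡ t₁ ⊎ y ≡ t₂ → z ≡ t₁ ⊎ z ≡ t₂ → x ≡ y ⊎ y ≡ z ⊎ x ≡ z
two-of-three-coincide (inj₁ refl) (inj₁ refl) _           = inj₁ refl
two-of-three-coincide (inj₂ refl) (inj₂ refl) _           = inj₁ refl
two-of-three-coincide _           (inj₁ refl) (inj₁ refl) = inj₂ (inj₁ refl)
two-of-three-coincide _           (inj₂ refl) (inj₂ refl) = inj₂ (inj₁ refl)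
two-of-three-coincide (inj₁ refl) _           (inj₁ refl) = inj₂ (inj₂ refl)
two-of-three-coincide (inj₂ refl) _           (inj₂ refl) = inj₂ (inj₂ refl)

xor-if-each-forces-xor : ∀ p q r → (p ≡ true → q xor r ≡ true) → (q ≡ true → p xor r ≡ true) →
                         (r ≡ true → p xor q ≡ true) → p ≡ q xor r
xor-if-each-forces-xor true  true  true  p⇒ _  _  with p⇒ refl
... | ()
xor-if-each-forces-xor true  false false p⇒ _  _  with p⇒ refl
... | ()
xor-if-each-forces-xor false true  false _  q⇒ _  with q⇒ refl
... | ()
xor-if-each-forces-xor false false true  _  _  r⇒ with r⇒ refl
... | ()
xor-if-each-forces-xor true  true  false _  _  _  = refl
xor-if-each-forces-xor true  false true  _  _  _  = refl
xor-if-each-forces-xor false true  true  _  _  _  = refl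
xor-if-each-forces-xor false false false _  _  _  = refl

module _ (d : ℕ) (Δ : SimplicialComplex (d + 2)) (NP : NormalPseudomanifold d Δ) where
  open NormalPseudomanifold NP using (pure; ridge)

  private
    V = Fin (d + 2)

  ∣∁pair∣≡d : ∀ {a b : V} → a ≢ b → ∣ ∁ (pair a b) ∣ ≡ d
  ∣∁pair∣≡d {a} {b} a≢b = +-cancelʳ-≡ 2 _ _ (begin
    ∣ ∁ (pair a b) ∣ + 2              ≡⟨ cong (∣ ∁ (pair a b) ∣ +_) (∣pair∣≡2 a≢b) ⟨
    ∣ ∁ (pair a b) ∣ + ∣ pair a b ∣   ≡⟨ ∣∁p∣+∣p∣≡n (pair a b) ⟩
    d + 2                             ∎)
    where open ≡-Reasoning

  ∣∁pair-a-a∣≡1+d : (a : V) → ∣ ∁ (pair a a) ∣ ≡ suc d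
  ∣∁pair-a-a∣≡1+d a = +-cancelʳ-≡ 1 _ _ (begin
    ∣ ∁ (pair a a) ∣ + 1              ≡⟨ cong (∣ ∁ (pair a a) ∣ +_) (∣pair-a-a∣≡1 a) ⟨
    ∣ ∁ (pair a a) ∣ + ∣ pair a a ∣   ≡⟨ ∣∁p∣+∣p∣≡n (pair a a) ⟩
    d + 2                             ≡⟨ +-suc d 1 ⟩
    suc d + 1                         ∎)
    where open ≡-Reasoning

  ∣∁triple∣+1≡d : ∀ {a b c : V} → a ≢ b → a ≢ c → b ≢ c → ∣ ∁ (triple a b c) ∣ + 1 ≡ d
  ∣∁triple∣+1≡d {a} {b} {c} a≢b a≢c b≢c = +-cancelʳ-≡ 2 _ _ (begin
    ∣ ∁ abc ∣ + 1 + 2        ≡⟨ +-assoc ∣ ∁ abc ∣ 1 2 ⟩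
    ∣ ∁ abc ∣ + 3            ≡⟨ cong (∣ ∁ abc ∣ +_) (∣triple∣≡3 a≢b a≢c b≢c) ⟨
    ∣ ∁ abc ∣ + ∣ abc ∣      ≡⟨ ∣∁p∣+∣p∣≡n abc ⟩
    d + 2                    ∎)
    where
    open ≡-Reasoning
    abc = triple a b c

  facet⇒∁pair : ∀ τ → Facet Δ τ → ∃₂ λ (a b : V) → a ≢ b × τ ≡ ∁ (pair a b)
  facet⇒∁pair τ τ-facet
    with ∣q∣<∣p∣⇒∃x∈p∉q {p = ⊤} (subst₂ _<_ (sym (pure τ τ-facet)) (sym (∣⊤∣≡n _)) (m<m+n d (s≤s z≤n)))
  ... | a , _ , a∉τ
    with ∣q∣<∣p∣⇒∃x∈p∉q {p = ∁ (pair a a)} (subst₂ _<_ (sym (pure τ τ-facet)) (sym (∣∁pair-a-a∣≡1+d a)) (n<1+n d))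
  ... | b , b∈∁aa , b∉τ =
    a , b , a≢b , p⊆q∧∣p∣≡∣q∣⇒p≡q (⊆∁pair a∉τ b∉τ) (trans (pure τ τ-facet) (sym (∣∁pair∣≡d a≢b)))
    where
    a≢b : a ≢ b
    a≢b refl = a∉∁pair b∈∁aa

  -- Bool-valued, so that the ridge condition becomes an identity in _xor_.
  cofacet : V → V → Bool
  cofacet a b = isFace Δ (∁ (pair a b))

  cofacet-sym : ∀ a b → cofacet a b ≡ cofacet b a
  cofacet-sym a b = cong (isFace Δ) (∁pair-comm a b)

  cofacet-irrefl : ∀ a → cofacet a a ≡ false
  cofacet-irrefl a = ¬-not λ aa∈Δ →
    <⇒≱ (n<1+n d) (subst (_≤ d) (∣∁pair-a-a∣≡1+d a) (∣face∣≤d Δ pure (∁ (pair a a)) aa∈Δ))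

  cofacet⇒facet : ∀ {a b} → a ≢ b → cofacet a b ≡ true → Facet Δ (∁ (pair a b))
  cofacet⇒facet {a} {b} a≢b ab∈Δ with facet-above Δ (∁ (pair a b)) ab∈Δ
  ... | τ , τ-facet , ab⊆τ =
    subst (Facet Δ) (sym (p⊆q∧∣p∣≡∣q∣⇒p≡q ab⊆τ (trans (∣∁pair∣≡d a≢b) (sym (pure τ τ-facet))))) τ-facet

  module Ridge {a b c : V} (a≢b : a ≢ b) (a≢c : a ≢ c) (b≢c : b ≢ c) where

    R : Subset (d + 2)
    R = ∁ (triple a b c)

    R⊆∁pair : ∀ {x y} → x ∈ triple a b c → y ∈ triple a b c → R ⊆ ∁ (pair x y)
    R⊆∁pair x∈abc y∈abc = p⊆q⇒∁p⊇∁q (pair⊆ x∈abc y∈abc)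

    ∈triple-if-R⊆∁pair : ∀ {x y} → R ⊆ ∁ (pair x y) → x ∈ triple a b c × y ∈ triple a b c
    ∈triple-if-R⊆∁pair R⊆xy = x∉∁p⇒x∈p (λ x∈R → a∉∁pair (R⊆xy x∈R))
                            , x∉∁p⇒x∈p (λ y∈R → b∉∁pair (R⊆xy y∈R))

    cofacet-in-triangle : cofacet a c ≡ false → cofacet b c ≡ false →
      ∀ {x y} → x ≡ a ⊎ x ≡ b ⊎ x ≡ c → y ≡ a ⊎ y ≡ b ⊎ y ≡ c → x ≢ y → cofacet x y ≡ true →
      ∁ (pair x y) ≡ ∁ (pair a b)
    cofacet-in-triangle ac bc (inj₁ refl)        (inj₁ refl)        x≢y _  = ⊥-elim (x≢y refl)
    cofacet-in-triangle ac bc (inj₁ refl)        (inj₂ (inj₁ refl)) _   _  = refl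
    cofacet-in-triangle ac bc (inj₁ refl)        (inj₂ (inj₂ refl)) _   xy = ⊥-elim (not-¬ xy ac)
    cofacet-in-triangle ac bc (inj₂ (inj₁ refl)) (inj₁ refl)        _   _  = ∁pair-comm b a
    cofacet-in-triangle ac bc (inj₂ (inj₁ refl)) (inj₂ (inj₁ refl)) x≢y _  = ⊥-elim (x≢y refl)
    cofacet-in-triangle ac bc (inj₂ (inj₁ refl)) (inj₂ (inj₂ refl)) _   xy = ⊥-elim (not-¬ xy bc)
    cofacet-in-triangle ac bc (inj₂ (inj₂ refl)) (inj₁ refl)        _   xy = ⊥-elim (not-¬ (trans (cofacet-sym a c) xy) ac)
    cofacet-in-triangle ac bc (inj₂ (inj₂ refl)) (inj₂ (inj₁ refl)) _   xy = ⊥-elim (not-¬ (trans (cofacet-sym b c) xy) bc)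
    cofacet-in-triangle ac bc (inj₂ (inj₂ refl)) (inj₂ (inj₂ refl)) x≢y _  = ⊥-elim (x≢y refl)

    facet-over-R : cofacet a c ≡ false → cofacet b c ≡ false →
      ∀ τ → Facet Δ τ → R ⊆ τ → τ ≡ ∁ (pair a b)
    facet-over-R ac bc τ τ-facet R⊆τ = over (facet⇒∁pair τ τ-facet)
      where
      over : (∃₂ λ (x y : V) → x ≢ y × τ ≡ ∁ (pair x y)) → τ ≡ ∁ (pair a b)
      over (x , y , x≢y , refl) =
        let x∈abc , y∈abc = ∈triple-if-R⊆∁pair R⊆τ in
        cofacet-in-triangle ac bc (x∈triple⁻ x∈abc) (x∈triple⁻ y∈abc) x≢y (proj₁ τ-facet)

    cofacet-ridge : cofacet a b ≡ true → cofacet a c xor cofacet b c ≡ true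
    cofacet-ridge ab with ridge R (down-closed Δ (R⊆∁pair a∈triple b∈triple) ab) (∣∁triple∣+1≡d a≢b a≢c b≢c)
                        | cofacet a c in ac | cofacet b c in bc
    ... | _ | true  | false = refl
    ... | _ | false | true  = refl
    ... | _ , _ , τ₁≢τ₂ , τ₁-facet , τ₂-facet , R⊆τ₁ , R⊆τ₂ , _ | false | false =
      ⊥-elim (τ₁≢τ₂ (trans (facet-over-R ac bc _ τ₁-facet R⊆τ₁) (sym (facet-over-R ac bc _ τ₂-facet R⊆τ₂))))
    ... | _ , _ , _ , _ , _ , _ , _ , over-R | true | true =
      ⊥-elim ([ ab≢ac , [ ac≢bc , ab≢bc ] ] (two-of-three-coincide (over-R _ (cofacet⇒facet a≢b ab) (R⊆∁pair a∈triple b∈triple))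
                                                           (over-R _ (cofacet⇒facet a≢c ac) (R⊆∁pair a∈triple c∈triple))
                                                           (over-R _ (cofacet⇒facet b≢c bc) (R⊆∁pair b∈triple c∈triple))))
      where
      c∈∁ab : c ∈ ∁ (pair a b)
      c∈∁ab = x∈∁pair⁺ (≢-sym a≢c) (≢-sym b≢c)
      ab≢ac : ∁ (pair a b) ≢ ∁ (pair a c)
      ab≢ac eq = b∉∁pair (subst (c ∈_) eq c∈∁ab)
      ab≢bc : ∁ (pair a b) ≢ ∁ (pair b c)
      ab≢bc eq = b∉∁pair (subst (c ∈_) eq c∈∁ab)
      ac≢bc : ∁ (pair a c) ≢ ∁ (pair b c)
      ac≢bc eq = a∉∁pair (subst (b ∈_) eq (x∈∁pair⁺ (≢-sym a≢b) b≢c))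

  cofacet-triangle : ∀ {a b c} → a ≢ b → a ≢ c → b ≢ c → cofacet a b ≡ cofacet c a xor cofacet c b
  cofacet-triangle {a} {b} {c} a≢b a≢c b≢c =
    xor-if-each-forces-xor (cofacet a b) (cofacet c a) (cofacet c b) ab⇒ ca⇒ cb⇒
    where
    open Ridge using (cofacet-ridge)
    ab⇒ : cofacet a b ≡ true → cofacet c a xor cofacet c b ≡ true
    ab⇒ ab = subst₂ (λ u v → u xor v ≡ true) (cofacet-sym a c) (cofacet-sym b c) (cofacet-ridge a≢b a≢c b≢c ab)
    ca⇒ : cofacet c a ≡ true → cofacet a b xor cofacet c b ≡ true
    ca⇒ ca = cofacet-ridge a≢c a≢b (≢-sym b≢c) (trans (cofacet-sym a c) ca)
    cb⇒ : cofacet c b ≡ true → cofacet a b xor cofacet c a ≡ true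
    cb⇒ cb = subst (λ u → u xor cofacet c a ≡ true) (cofacet-sym b a)
                   (cofacet-ridge b≢c (≢-sym a≢b) (≢-sym a≢c) (trans (cofacet-sym b c) cb))

  cofacet≡xor : ∀ b₀ x y → cofacet x y ≡ cofacet b₀ x xor cofacet b₀ y
  cofacet≡xor b₀ x y with x ≟ᶠ y | x ≟ᶠ b₀ | y ≟ᶠ b₀
  ... | yes refl | _        | _        = trans (cofacet-irrefl x) (sym (xor-same (cofacet b₀ x)))
  ... | no _     | yes refl | _        = cong (_xor cofacet x y) (sym (cofacet-irrefl x))
  ... | no _     | no _     | yes refl =
    trans (cofacet-sym x y) (sym (trans (cong (cofacet y x xor_) (cofacet-irrefl y)) (xor-identityʳ _)))
  ... | no x≢y   | no x≢b₀  | no y≢b₀  = cofacet-triangle x≢y x≢b₀ y≢b₀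

  face⇒missing-cofacet : ∀ σ → Face Δ σ → ∃₂ λ a b → cofacet a b ≡ true × a ∉ σ × b ∉ σ
  face⇒missing-cofacet σ σ∈Δ =
    let τ , τ-facet , σ⊆τ = facet-above Δ σ σ∈Δ
        a , b , _ , τ≡ab = facet⇒∁pair τ τ-facet
        σ⊆ab = λ {x} x∈σ → subst (x ∈_) τ≡ab (σ⊆τ x∈σ)
    in a , b , subst (Face Δ) τ≡ab (proj₁ τ-facet) , (λ a∈σ → a∉∁pair (σ⊆ab a∈σ)) , (λ b∈σ → b∉∁pair (σ⊆ab b∈σ))

  module Bipartition (b₀ : V) where

    side : Subset (d + 2)
    side = tabulate (cofacet b₀)

    b₀∉side : b₀ ∉ side
    b₀∉side = x∉tabulate⁺ (cofacet-irrefl b₀)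

    cofacet⇒separated : ∀ {a b} → cofacet a b ≡ true → (a ∈ side × b ∉ side) ⊎ (b ∈ side × a ∉ side)
    cofacet⇒separated {a} {b} ab with cofacet b₀ a in b₀a | cofacet b₀ b in b₀b
    ... | true  | false = inj₁ (x∈tabulate⁺ b₀a , x∉tabulate⁺ b₀b)
    ... | false | true  = inj₂ (x∈tabulate⁺ b₀b , x∉tabulate⁺ b₀a)
    ... | true  | true  = ⊥-elim (not-¬ ab (trans (cofacet≡xor b₀ a b) (cong₂ _xor_ b₀a b₀b)))
    ... | false | false = ⊥-elim (not-¬ ab (trans (cofacet≡xor b₀ a b) (cong₂ _xor_ b₀a b₀b)))

    separated⇒cofacet : ∀ {a b} → a ∈ side → b ∉ side → cofacet a b ≡ true
    separated⇒cofacet {a} {b} a∈side b∉side = begin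
      cofacet a b                     ≡⟨ cofacet≡xor b₀ a b ⟩
      cofacet b₀ a xor cofacet b₀ b   ≡⟨ cong₂ _xor_ (x∈tabulate⁻ a∈side) (¬-not λ b₀b → b∉side (x∈tabulate⁺ b₀b)) ⟩
      true                            ∎
      where open ≡-Reasoning

    face⇒join : ∀ σ → Face Δ σ → JoinOfBoundaries side σ
    face⇒join σ σ∈Δ =
      let a , b , ab , a∉σ , b∉σ = face⇒missing-cofacet σ σ∈Δ
      in [ (λ (a∈side , b∉side) → join-of-missing a∈side a∉σ b∉side b∉σ)
         , (λ (b∈side , a∉side) → join-of-missing b∈side b∉σ a∉side a∉σ)
         ] (cofacet⇒separated ab)

    join⇒face : ∀ σ → JoinOfBoundaries side σ → Face Δ σ
    join⇒face σ σ-join with missing-from-join σ-join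
    ... | a , b , a∈side , a∉σ , b∉side , b∉σ = down-closed Δ (⊆∁pair a∉σ b∉σ) (separated⇒cofacet a∈side b∉side)

lemma4p1 : (d : ℕ) (Δ : SimplicialComplex (d + 2)) →
    NormalPseudomanifold d Δ → IsJoinOfTwoSimplexBoundaries Δ
lemma4p1 d Δ NP =
  let a₀ , b₀ , a₀b₀ , _ = face⇒missing-cofacet d Δ NP ⊥ (empty-face Δ)
      open Bipartition d Δ NP b₀
  in side , (a₀ , x∈tabulate⁺ (trans (cofacet-sym d Δ NP b₀ a₀) a₀b₀)) , (b₀ , x∉p⇒x∈∁p b₀∉side) ,
     λ σ → face⇒join σ , join⇒face σ
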